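{- For any integer $m\ge2$, any set $V\subseteq[m]$ and any integer $n\ge1$, \[H^{(1)}_n(D^{(m,V)})=\begin{cases}H_n(D^{(m,V-1)}) & \text{if } 1\notin V,\\ H_n(-1+D^{(m,V-1)}) & \text{if } 1\in V.\end{cases}\]
   Context: For an integer $m\ge 2$ and $V\subseteq[m]=\{1,\dots,m\}$, let $(m,V)=\{k\in\mathbb{Z}^+ : k\equiv j \pmod m \text{ for some } j\in V\}$, and for an integer $t$ let $V+t=\{k\in[m]: k\equiv j+t \pmod m \text{ for some } j\in V\}$. A Dyck path of size $n$ is a lattice path from $(0,0)$ to $(2n,0)$ with steps $(1,1)$ and $(1,-1)$ never going below the $x$-axis; a peak is an up-step immediately followed by a down-step, and its height is the $y$-coordinate of the point between them. Let $d_n^{(m,V)}$ be the number of Dyck paths of size $n$ none of whose peaks has height in $(m,V)$, and $D^{(m,V)}(x)=\sum_{n\ge0}d_n^{(m,V)}x^n$. For a power series $F=\sum f_nx^n$, $n\ge1$, $k\ge0$: $H^{(k)}_n(F)=\det(f_{k+i+j})_{0\le i,j\le n-1}$ and $H_n(F)=H^{(0)}_n(F)$; $-1+F$ denotes $F(x)-1$. -}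

module Defs where

open import Data.Bool using (Bool; true; false; not; _∧_; _∨_; if_then_else_)
open import Data.Nat using (ℕ; zero; suc; _+_; _*_; _∸_; _≡ᵇ_; _≤ᵇ_; NonZero)
open import Data.Nat.DivMod using (_%_)
open import Data.Integer as ℤ using (ℤ; +_; -[1+_]; ∣_∣)
open import Data.Fin using (Fin; toℕ; punchIn)
import Data.Fin as Fin
open import Data.List using (List; []; _∷_; length; filter; map; concatMap; _++_)
open import Data.Bool.ListAction using (any)
open import Data.List using (allFin)
open import Relation.Nullary.Decidable using (Dec; yes; no)
open import Data.Bool using (T)
open import Data.Bool.Properties using (T?)

-- Subsets V ⊆ [m] = {1,…,m} are represented as  V : Fin m → Bool,
-- where the index  i : Fin m  stands for the integer  toℕ i + 1.

_∈ᵇ_ : {m : ℕ} → ℕ → (Fin m → Bool) → Bool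
_∈ᵇ_ {m} k V = any (λ i → (suc (toℕ i) ≡ᵇ k) ∧ V i) (allFin m)

congℤ : (m : ℕ) .{{_ : NonZero m}} → ℤ → ℤ → Bool
congℤ m a b = (∣ a ℤ.- b ∣ % m) ≡ᵇ 0

-- V + t = { k ∈ [m] : k ≡ j + t (mod m) for some j ∈ V }
shift : {m : ℕ} .{{_ : NonZero m}} → (Fin m → Bool) → ℤ → (Fin m → Bool)
shift {m} V t k =
  any (λ j → V j ∧ congℤ m (+ suc (toℕ k)) ((+ suc (toℕ j)) ℤ.+ t)) (allFin m)

inClass : (m : ℕ) .{{_ : NonZero m}} → (Fin m → Bool) → ℕ → Bool
inClass m V zero = false
inClass m V (suc h) =
  any (λ j → V j ∧ congℤ m (+ suc h) (+ suc (toℕ j))) (allFin m)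

-- Lattice paths: a path is a list of steps, true = up (1,1), false = down (1,-1).

allPaths : ℕ → List (List Bool)
allPaths zero = [] ∷ []
allPaths (suc l) = map (true ∷_) (allPaths l) ++ map (false ∷_) (allPaths l)

isDyckFrom : ℕ → List Bool → Bool
isDyckFrom h [] = h ≡ᵇ 0
isDyckFrom h (true ∷ s) = isDyckFrom (suc h) s
isDyckFrom zero (false ∷ s) = false
isDyckFrom (suc h) (false ∷ s) = isDyckFrom h s

-- starting at height h, no peak has a height in the "bad" set
-- (a peak is an up-step followed by a down-step; its height is that of the point between them)
peaksAvoid : (ℕ → Bool) → ℕ → List Bool → Bool
peaksAvoid bad h [] = true
peaksAvoid bad h (true ∷ false ∷ s) = not (bad (suc h)) ∧ peaksAvoid bad (suc h) (false ∷ s)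
peaksAvoid bad h (true ∷ s) = peaksAvoid bad (suc h) s
peaksAvoid bad h (false ∷ s) = peaksAvoid bad (h ∸ 1) s

dCount : (m : ℕ) .{{_ : NonZero m}} → (Fin m → Bool) → ℕ → ℕ
dCount m V n =
  length (filter (λ p → T? (isDyckFrom 0 p ∧ peaksAvoid (inClass m V) 0 p))
                 (allPaths (2 * n)))

-- Power series are represented by their coefficient sequences ℕ → ℤ.

Series : Set
Series = ℕ → ℤ

D : (m : ℕ) .{{_ : NonZero m}} → (Fin m → Bool) → Series
D m V n = + dCount m V n

minusOne : Series → Series
minusOne F zero = F zero ℤ.- + 1
minusOne F (suc n) = F (suc n)

sumFin : (n : ℕ) → (Fin n → ℤ) → ℤ
sumFin zero f = + 0
sumFin (suc n) f = f Fin.zero ℤ.+ sumFin n (λ i → f (Fin.suc i))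

sign : ℕ → ℤ
sign zero = + 1
sign (suc k) = ℤ.- sign k

det : (n : ℕ) → (Fin n → Fin n → ℤ) → ℤ
det zero M = + 1
det (suc n) M =
  sumFin (suc n) (λ j → sign (toℕ j) ℤ.* M Fin.zero j
                         ℤ.* det n (λ r c → M (Fin.suc r) (punchIn j c)))

hankel : ℕ → ℕ → Series → ℤ
hankel k n F = det n (λ i j → F (k + toℕ i + toℕ j))

-- Cutting a Dyck path at its first return to the axis gives D = 1 + x G D, where g_j counts the
-- prime paths of size j + 1 (those touching the axis only at their ends) with no peak height in
-- (m,V). Such a path is an up-step, a lifted Dyck path of size j and a down-step, and lifting
-- raises every peak by one; so g_j = d_j^{(m,V-1)} for j ≥ 1, while g_0 is 1 or 0 according as
-- 1 ∉ V or 1 ∈ V. It remains to see that H^{(1)}_n(F) = H_n(G) whenever F = 1 + x G F. Let C_{ij}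
-- be the coefficient of x^j in x^{-i} (G - G_{<i}) F. Subtracting g-multiples of earlier rows
-- turns (f_{1+i+j}) into C and (g_{i+j}) into the transpose of C, and such row operations do not
-- change determinants.

{-# OPTIONS --safe #-}
module Submission where

open import Defs
open import Data.Nat using (ℕ; _≤_; NonZero)
open import Data.Fin using (Fin)
open import Data.Bool using (Bool; true; false)
open import Data.Integer using (-[1+_])
open import Data.Product using (_×_)
open import Relation.Binary.PropositionalEquality using (_≡_)

open import Data.Nat as ℕ using (zero; suc; _<_; _≤?_; _<?_; _<ᵇ_; _≡ᵇ_; _∸_; z≤n; s≤s)
import Data.Nat.Properties as ℕP
open import Data.Nat.Induction using (<-rec)
open import Data.Nat.DivMod using (_%_; _/_; m≡m%n+[m/n]*n; %-remove-+ʳ; m*n%n≡0; %-distribˡ-+; m%n<n; m%n%n≡m%n; m<n⇒m%n≡m)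
open import Data.Nat.Divisibility using (m%n≡0⇒n∣m)
open import Data.Integer as ℤ using (ℤ; _+_; _*_; -_; 0ℤ; 1ℤ; ∣_∣; _⊖_)
import Data.Integer.Properties as ℤP
open import Data.Integer.Tactic.RingSolver using (solve-∀)
open import Data.Bool using (T; not; _∧_; if_then_else_)
import Data.Bool.Properties as BoolP
open import Data.Bool.ListAction using (any; or)
open import Data.List using (List; []; _∷_; length; filter; map; _++_; allFin)
import Data.List.Properties as ListP
open import Data.List.Relation.Unary.Any.Properties using (any⁺; any⁻; tabulate⁺; tabulate⁻)
open import Data.Fin as Fin using (zero; suc; toℕ; punchIn; inject₁; fromℕ<)
open import Data.Fin.Properties as FinP using (_≟_)
open import Data.Product using (_,_; ∃-syntax)
open import Data.Sum using (inj₁; inj₂)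
open import Data.Empty using (⊥-elim)
open import Relation.Nullary using (¬_; yes; no)
open import Relation.Nullary.Decidable using (T?)
open import Relation.Binary.PropositionalEquality using (_≢_; refl; sym; trans; cong; cong₂; subst; module ≡-Reasoning)
open import Function using (_∘_; Equivalence)

-- Finite sums and determinants

sumFin-cong : ∀ n {f g : Fin n → ℤ} → (∀ i → f i ≡ g i) → sumFin n f ≡ sumFin n g
sumFin-cong zero    f≗g = refl
sumFin-cong (suc n) f≗g = cong₂ _+_ (f≗g zero) (sumFin-cong n (f≗g ∘ suc))

sumFin-0 : ∀ n → sumFin n (λ _ → 0ℤ) ≡ 0ℤ
sumFin-0 zero    = refl
sumFin-0 (suc n) = trans (ℤP.+-identityˡ _) (sumFin-0 n)

sumFin-distrib-+ : ∀ n (f g : Fin n → ℤ) → sumFin n (λ i → f i + g i) ≡ sumFin n f + sumFin n g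
sumFin-distrib-+ zero    f g = refl
sumFin-distrib-+ (suc n) f g =
  trans (cong (f zero + g zero +_) (sumFin-distrib-+ n (f ∘ suc) (g ∘ suc)))
        (interchange (f zero) (g zero) _ _)
  where
  interchange : ∀ a b s t → (a + b) + (s + t) ≡ (a + s) + (b + t)
  interchange = solve-∀

*-distribˡ-sumFin : ∀ n a (f : Fin n → ℤ) → a * sumFin n f ≡ sumFin n (λ i → a * f i)
*-distribˡ-sumFin zero    a f = ℤP.*-zeroʳ a
*-distribˡ-sumFin (suc n) a f =
  trans (ℤP.*-distribˡ-+ a (f zero) _) (cong (a * f zero +_) (*-distribˡ-sumFin n a (f ∘ suc)))

neg-distrib-sumFin : ∀ n (f : Fin n → ℤ) → - sumFin n f ≡ sumFin n (λ i → - f i)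
neg-distrib-sumFin zero    f = refl
neg-distrib-sumFin (suc n) f =
  trans (ℤP.neg-distrib-+ (f zero) _) (cong (- f zero +_) (neg-distrib-sumFin n (f ∘ suc)))

sumFin-linear : ∀ n a b (f g : Fin n → ℤ) →
                sumFin n (λ i → a * f i + b * g i) ≡ a * sumFin n f + b * sumFin n g
sumFin-linear n a b f g =
  trans (sumFin-distrib-+ n (λ i → a * f i) (λ i → b * g i))
        (sym (cong₂ _+_ (*-distribˡ-sumFin n a f) (*-distribˡ-sumFin n b g)))

sumFin-comm : ∀ n m (f : Fin n → Fin m → ℤ) →
              sumFin n (λ i → sumFin m (f i)) ≡ sumFin m (λ j → sumFin n (λ i → f i j))
sumFin-comm zero    m f = sym (sumFin-0 m)
sumFin-comm (suc n) m f =
  trans (cong (sumFin m (f zero) +_) (sumFin-comm n m (f ∘ suc)))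
        (sym (sumFin-distrib-+ m (f zero) (λ j → sumFin n (λ i → f (suc i) j))))

Matrix : ℕ → Set
Matrix n = Fin n → Fin n → ℤ

minor : ∀ {n} → Fin (suc n) → Fin (suc n) → Matrix (suc n) → Matrix n
minor i j M r c = M (punchIn i r) (punchIn j c)

firstRowTerm : ∀ {n} → Matrix (suc n) → Fin (suc n) → ℤ
firstRowTerm {n} M j = sign (toℕ j) * M zero j * det n (minor zero j M)

firstColumnTerm : ∀ {n} → Matrix (suc n) → Fin (suc n) → ℤ
firstColumnTerm {n} M i = sign (toℕ i) * M i zero * det n (minor i zero M)

det-cong : ∀ n {M N : Matrix n} → (∀ i j → M i j ≡ N i j) → det n M ≡ det n N
det-cong zero    M≗N = refl
det-cong (suc n) M≗N = sumFin-cong (suc n) λ j →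
  cong₂ (λ x y → sign (toℕ j) * x * y) (M≗N zero j) (det-cong n (λ r c → M≗N (suc r) (punchIn j c)))

det-expandColumn₀ : ∀ n (M : Matrix (suc n)) →
  det (suc n) M ≡ sumFin (suc n) (firstColumnTerm M)
det-expandColumn₀ zero    M = refl
det-expandColumn₀ (suc n) M = cong (sign 0 * M zero zero * det (suc n) (minor zero zero M) +_) (begin
    sumFin (suc n) (λ j → ρ′ j * det (suc n) (minor zero (suc j) M))
  ≡⟨ sumFin-cong (suc n) (λ j → cong (ρ′ j *_) (det-expandColumn₀ n (minor zero (suc j) M))) ⟩
    sumFin (suc n) (λ j → ρ′ j * sumFin (suc n) (λ i → κ i * d i j))
  ≡⟨ sumFin-cong (suc n) (λ j → *-distribˡ-sumFin (suc n) (ρ′ j) (λ i → κ i * d i j)) ⟩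
    sumFin (suc n) (λ j → sumFin (suc n) (λ i → ρ′ j * (κ i * d i j)))
  ≡⟨ sumFin-comm (suc n) (suc n) (λ j i → ρ′ j * (κ i * d i j)) ⟩
    sumFin (suc n) (λ i → sumFin (suc n) (λ j → ρ′ j * (κ i * d i j)))
  ≡⟨ sumFin-cong (suc n) (λ i → sumFin-cong (suc n) (λ j →
       exchange (sign (toℕ j)) (sign (toℕ i)) (M zero (suc j)) (M (suc i) zero) (d i j))) ⟩
    sumFin (suc n) (λ i → sumFin (suc n) (λ j → κ′ i * (ρ j * d i j)))
  ≡⟨ sumFin-cong (suc n) (λ i → sym (*-distribˡ-sumFin (suc n) (κ′ i) (λ j → ρ j * d i j))) ⟩
    sumFin (suc n) (λ i → κ′ i * det (suc n) (minor (suc i) zero M))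
  ∎)
  where
  open ≡-Reasoning
  ρ ρ′ κ κ′ : Fin (suc n) → ℤ
  ρ  j = sign (toℕ j) * M zero (suc j)
  ρ′ j = - sign (toℕ j) * M zero (suc j)
  κ  i = sign (toℕ i) * M (suc i) zero
  κ′ i = - sign (toℕ i) * M (suc i) zero
  -- Deleting rows 0, i + 1 and columns 0, j + 1 in either order gives the same minor d i j.
  d : Fin (suc n) → Fin (suc n) → ℤ
  d i j = det n (λ r c → M (suc (punchIn i r)) (suc (punchIn j c)))
  exchange : ∀ sj si a b x → - sj * a * (si * b * x) ≡ - si * b * (sj * a * x)
  exchange = solve-∀

det-transpose : ∀ n (M : Matrix n) → det n (λ i j → M j i) ≡ det n M
det-transpose zero    M = refl
det-transpose (suc n) M =
  trans (sumFin-cong (suc n) (λ j → cong (sign (toℕ j) * M j zero *_) (det-transpose n (minor j zero M))))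
        (sym (det-expandColumn₀ n M))

det-linearInRow : ∀ n (k : Fin n) (a b : ℤ) (M N P : Matrix n) →
  (∀ r → r ≢ k → ∀ c → P r c ≡ M r c) → (∀ r → r ≢ k → ∀ c → N r c ≡ M r c) →
  (∀ c → P k c ≡ a * M k c + b * N k c) → det n P ≡ a * det n M + b * det n N
det-linearInRow (suc n) zero a b M N P P≗M N≗M P₀ =
  trans (sumFin-cong (suc n) term) (sumFin-linear (suc n) a b (firstRowTerm M) (firstRowTerm N))
  where
  open ≡-Reasoning
  distribute : ∀ s a b x y d → s * (a * x + b * y) * d ≡ a * (s * x * d) + b * (s * y * d)
  distribute = solve-∀
  term : ∀ j → firstRowTerm P j ≡ a * firstRowTerm M j + b * firstRowTerm N j
  term j = begin
      sign (toℕ j) * P zero j * det n (minor zero j P)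
    ≡⟨ cong₂ (λ x y → sign (toℕ j) * x * y) (P₀ j) (det-cong n (λ r c → P≗M (suc r) (λ ()) (punchIn j c))) ⟩
      sign (toℕ j) * (a * M zero j + b * N zero j) * det n (minor zero j M)
    ≡⟨ distribute (sign (toℕ j)) a b (M zero j) (N zero j) (det n (minor zero j M)) ⟩
      a * firstRowTerm M j + b * (sign (toℕ j) * N zero j * det n (minor zero j M))
    ≡⟨ cong (λ y → a * firstRowTerm M j + b * (sign (toℕ j) * N zero j * y))
            (det-cong n (λ r c → sym (N≗M (suc r) (λ ()) (punchIn j c)))) ⟩
      a * firstRowTerm M j + b * firstRowTerm N j
    ∎
det-linearInRow (suc n) (suc k) a b M N P P≗M N≗M Pₖ =
  trans (sumFin-cong (suc n) term) (sumFin-linear (suc n) a b (firstRowTerm M) (firstRowTerm N))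
  where
  open ≡-Reasoning
  distribute : ∀ s a b x d e → s * x * (a * d + b * e) ≡ a * (s * x * d) + b * (s * x * e)
  distribute = solve-∀
  term : ∀ j → firstRowTerm P j ≡ a * firstRowTerm M j + b * firstRowTerm N j
  term j = begin
      sign (toℕ j) * P zero j * det n (minor zero j P)
    ≡⟨ cong₂ (λ x y → sign (toℕ j) * x * y) (P≗M zero (λ ()) j)
         (det-linearInRow n k a b (minor zero j M) (minor zero j N) (minor zero j P)
           (λ r r≢k c → P≗M (suc r) (r≢k ∘ FinP.suc-injective) (punchIn j c))
           (λ r r≢k c → N≗M (suc r) (r≢k ∘ FinP.suc-injective) (punchIn j c))
           (λ c → Pₖ (punchIn j c))) ⟩
      sign (toℕ j) * M zero j * (a * det n (minor zero j M) + b * det n (minor zero j N))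
    ≡⟨ distribute (sign (toℕ j)) a b (M zero j) (det n (minor zero j M)) (det n (minor zero j N)) ⟩
      a * firstRowTerm M j + b * (sign (toℕ j) * M zero j * det n (minor zero j N))
    ≡⟨ cong (λ x → a * firstRowTerm M j + b * (sign (toℕ j) * x * det n (minor zero j N))) (sym (N≗M zero (λ ()) j)) ⟩
      a * firstRowTerm M j + b * firstRowTerm N j
    ∎

-- Expanding along the first column, the cofactors of rows 0 and 1 trade places, while the minors
-- of the other rows again have their first two rows swapped.
mutual
  det-swap₀₁ : ∀ n (M M′ : Matrix (suc (suc n))) →
    (∀ c → M′ zero c ≡ M (suc zero) c) → (∀ c → M′ (suc zero) c ≡ M zero c) →
    (∀ r c → M′ (suc (suc r)) c ≡ M (suc (suc r)) c) → det (suc (suc n)) M′ ≡ - det (suc (suc n)) M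
  det-swap₀₁ n M M′ h₀ h₁ hᵣ = begin
      det (suc (suc n)) M′
    ≡⟨ det-expandColumn₀ (suc n) M′ ⟩
      t′ zero + (t′ (suc zero) + sumFin n (λ r → t′ (suc (suc r))))
    ≡⟨ cong₂ _+_ e₀ (cong₂ _+_ e₁ (trans (sumFin-cong n (det-swap₀₁-term n M M′ h₀ h₁ hᵣ))
                                         (sym (neg-distrib-sumFin n (λ r → t (suc (suc r))))))) ⟩
      - t (suc zero) + (- t zero + - sumFin n (λ r → t (suc (suc r))))
    ≡⟨ regroup (t zero) (t (suc zero)) (sumFin n (λ r → t (suc (suc r)))) ⟩
      - (t zero + (t (suc zero) + sumFin n (λ r → t (suc (suc r)))))
    ≡⟨ cong -_ (sym (det-expandColumn₀ (suc n) M)) ⟩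
      - det (suc (suc n)) M
    ∎
    where
    open ≡-Reasoning
    t t′ : Fin (suc (suc n)) → ℤ
    t  = firstColumnTerm M
    t′ = firstColumnTerm M′
    regroup : ∀ a b s → - b + (- a + - s) ≡ - (a + (b + s))
    regroup = solve-∀
    flip : ∀ σ x d → σ * x * d ≡ - (- σ * x * d)
    flip = solve-∀
    e₀ : t′ zero ≡ - t (suc zero)
    e₀ = trans (cong₂ (λ x y → 1ℤ * x * y) (h₀ zero)
                 (det-cong (suc n) {minor zero zero M′} {minor (suc zero) zero M}
                   (λ { zero c → h₁ (suc c) ; (suc r) c → hᵣ r (suc c) })))
               (flip 1ℤ (M (suc zero) zero) (det (suc n) (minor (suc zero) zero M)))
    e₁ : t′ (suc zero) ≡ - t zero
    e₁ = trans (cong₂ (λ x y → - 1ℤ * x * y) (h₁ zero)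
                 (det-cong (suc n) {minor (suc zero) zero M′} {minor zero zero M}
                   (λ { zero c → h₀ (suc c) ; (suc r) c → hᵣ r (suc c) })))
               (flip (- 1ℤ) (M zero zero) (det (suc n) (minor zero zero M)))

  det-swap₀₁-term : ∀ n (M M′ : Matrix (suc (suc n))) →
    (∀ c → M′ zero c ≡ M (suc zero) c) → (∀ c → M′ (suc zero) c ≡ M zero c) →
    (∀ r c → M′ (suc (suc r)) c ≡ M (suc (suc r)) c) →
    (r : Fin n) → firstColumnTerm M′ (suc (suc r)) ≡ - firstColumnTerm M (suc (suc r))
  det-swap₀₁-term (suc n) M M′ h₀ h₁ hᵣ r =
    trans (cong₂ (λ x y → sign (toℕ (suc (suc r))) * x * y) (hᵣ r zero)
            (det-swap₀₁ n (minor (suc (suc r)) zero M) (minor (suc (suc r)) zero M′)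
              (h₀ ∘ suc) (h₁ ∘ suc) (λ r′ → hᵣ (punchIn r r′) ∘ suc)))
          (sym (ℤP.neg-distribʳ-* (sign (toℕ (suc (suc r))) * M (suc (suc r)) zero)
                                  (det (suc (suc n)) (minor (suc (suc r)) zero M))))

det-swapAdjacent : ∀ n (i : Fin n) (M M′ : Matrix (suc n)) →
  (∀ c → M′ (inject₁ i) c ≡ M (suc i) c) → (∀ c → M′ (suc i) c ≡ M (inject₁ i) c) →
  (∀ r → r ≢ inject₁ i → r ≢ suc i → ∀ c → M′ r c ≡ M r c) → det (suc n) M′ ≡ - det (suc n) M
det-swapAdjacent (suc n) zero    M M′ h₀ h₁ hᵣ = det-swap₀₁ n M M′ h₀ h₁ (λ r → hᵣ (suc (suc r)) (λ ()) (λ ()))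
det-swapAdjacent (suc n) (suc i) M M′ h₀ h₁ hᵣ =
  trans (sumFin-cong (suc (suc n)) term) (sym (neg-distrib-sumFin (suc (suc n)) (firstRowTerm M)))
  where
  term : ∀ j → firstRowTerm M′ j ≡ - firstRowTerm M j
  term j = trans (cong₂ (λ x y → sign (toℕ j) * x * y) (hᵣ zero (λ ()) (λ ()) j)
                   (det-swapAdjacent n i (minor zero j M) (minor zero j M′) (h₀ ∘ punchIn j) (h₁ ∘ punchIn j)
                     (λ r r≢i r≢1+i → hᵣ (suc r) (r≢i ∘ FinP.suc-injective) (r≢1+i ∘ FinP.suc-injective) ∘ punchIn j)))
                 (sym (ℤP.neg-distribʳ-* (sign (toℕ j) * M zero j) (det (suc n) (minor zero j M))))

x≡-x⇒x≡0 : ∀ {x} → x ≡ - x → x ≡ 0ℤ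
x≡-x⇒x≡0 {ℤ.+ zero}  _ = refl
x≡-x⇒x≡0 {ℤ.+ suc _} ()
x≡-x⇒x≡0 {ℤ.-[1+ _ ]} ()

det-adjacentEqualRows : ∀ n (i : Fin n) (M : Matrix (suc n)) →
  (∀ c → M (inject₁ i) c ≡ M (suc i) c) → det (suc n) M ≡ 0ℤ
det-adjacentEqualRows n i M eq = x≡-x⇒x≡0 (det-swapAdjacent n i M M eq (sym ∘ eq) (λ _ _ _ _ → refl))

swapRows : ∀ {n} → Fin n → Matrix (suc n) → Matrix (suc n)
swapRows i M r c with r ≟ inject₁ i
... | yes _ = M (suc i) c
... | no _ with r ≟ suc i
...   | yes _ = M (inject₁ i) c
...   | no _  = M r c

suc≢inject₁ : ∀ {n} (i : Fin n) → suc i ≢ inject₁ i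
suc≢inject₁ zero    ()
suc≢inject₁ (suc i) eq = suc≢inject₁ i (FinP.suc-injective eq)

swapRows-inject₁ : ∀ {n} (i : Fin n) M c → swapRows i M (inject₁ i) c ≡ M (suc i) c
swapRows-inject₁ i M c with inject₁ i ≟ inject₁ i
... | yes _ = refl
... | no ≢  = ⊥-elim (≢ refl)

swapRows-suc : ∀ {n} (i : Fin n) M c → swapRows i M (suc i) c ≡ M (inject₁ i) c
swapRows-suc i M c with suc i ≟ inject₁ i
... | yes eq = ⊥-elim (suc≢inject₁ i eq)
... | no _ with suc i ≟ suc i
...   | yes _ = refl
...   | no ≢  = ⊥-elim (≢ refl)

swapRows-other : ∀ {n} (i : Fin n) M r → r ≢ inject₁ i → r ≢ suc i → ∀ c → swapRows i M r c ≡ M r c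
swapRows-other i M r r≢i r≢1+i c with r ≟ inject₁ i
... | yes eq = ⊥-elim (r≢i eq)
... | no _ with r ≟ suc i
...   | yes eq = ⊥-elim (r≢1+i eq)
...   | no _   = refl

det-equalRows : ∀ n (M : Matrix n) {p q : Fin n} → toℕ p < toℕ q → (∀ c → M p c ≡ M q c) → det n M ≡ 0ℤ
det-equalRows n M {p} {q} p<q = atDistance (toℕ q ∸ suc (toℕ p)) n M p q (sym (ℕP.m+[n∸m]≡n p<q))
  where
  -- Swapping q with the row above it brings the two equal rows closer together.
  atDistance : ∀ d n (M : Matrix n) (p q : Fin n) → toℕ q ≡ suc (toℕ p ℕ.+ d) →
               (∀ c → M p c ≡ M q c) → det n M ≡ 0ℤ
  atDistance d       (suc n) M p zero    () _
  atDistance zero    (suc n) M p (suc q) q≡ eq =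
    det-adjacentEqualRows n q M (λ c → trans (cong (λ r → M r c) (sym p≡q)) (eq c))
    where
    p≡q : p ≡ inject₁ q
    p≡q = FinP.toℕ-injective
            (trans (sym (ℕP.+-identityʳ (toℕ p))) (sym (trans (FinP.toℕ-inject₁ q) (ℕP.suc-injective q≡))))
  atDistance (suc d) (suc n) M p (suc q) q≡ eq =
    ℤP.neg-injective (trans (sym (det-swapAdjacent n q M M′ (swapRows-inject₁ q M) (swapRows-suc q M) (swapRows-other q M)))
                            (atDistance d (suc n) M′ p (inject₁ q) q′≡ (λ c → trans (swapRows-other q M p p≢q p≢1+q c)
                                                                                     (trans (eq c) (sym (swapRows-inject₁ q M c))))))
    where
    M′ = swapRows q M
    q′≡ : toℕ (inject₁ q) ≡ suc (toℕ p ℕ.+ d)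
    q′≡ = trans (FinP.toℕ-inject₁ q) (trans (ℕP.suc-injective q≡) (ℕP.+-suc (toℕ p) d))
    p≢q : p ≢ inject₁ q
    p≢q refl = ℕP.<⇒≢ (ℕP.m≤m+n (suc (toℕ p)) d) q′≡
    p≢1+q : p ≢ suc q
    p≢1+q refl = ℕP.<⇒≢ (ℕP.m≤m+n (suc (toℕ p)) (suc d)) q≡

setRow : ∀ {n} → Fin n → (Fin n → ℤ) → Matrix n → Matrix n
setRow k v M r c with r ≟ k
... | yes _ = v c
... | no _  = M r c

setRow-same : ∀ {n} (k : Fin n) v M c → setRow k v M k c ≡ v c
setRow-same k v M c with k ≟ k
... | yes _ = refl
... | no ≢  = ⊥-elim (≢ refl)

setRow-other : ∀ {n} (k : Fin n) v M r → r ≢ k → ∀ c → setRow k v M r c ≡ M r c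
setRow-other k v M r r≢k c with r ≟ k
... | yes eq = ⊥-elim (r≢k eq)
... | no _   = refl

det-setRow-linear : ∀ n t (k : Fin n) (μ : Fin t → ℤ) (w : Fin t → Fin n → ℤ) (M : Matrix n) →
  det n (setRow k (λ c → sumFin t (λ a → μ a * w a c)) M) ≡ sumFin t (λ a → μ a * det n (setRow k (w a) M))
det-setRow-linear n zero    k μ w M =
  det-linearInRow n k 0ℤ 0ℤ M M (setRow k (λ _ → 0ℤ) M) (setRow-other k _ M) (λ _ _ _ → refl) (setRow-same k _ M)
det-setRow-linear n (suc t) k μ w M = begin
    det n (setRow k (λ c → sumFin (suc t) (λ a → μ a * w a c)) M)
  ≡⟨ det-linearInRow n k (μ zero) 1ℤ (setRow k (w zero) M) (setRow k rest M)
       (setRow k (λ c → sumFin (suc t) (λ a → μ a * w a c)) M)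
       (λ r r≢k c → trans (setRow-other k _ M r r≢k c) (sym (setRow-other k _ M r r≢k c)))
       (λ r r≢k c → trans (setRow-other k _ M r r≢k c) (sym (setRow-other k _ M r r≢k c)))
       (λ c → trans (setRow-same k _ M c)
                    (sym (cong₂ _+_ (cong (μ zero *_) (setRow-same k (w zero) M c))
                                    (trans (cong (1ℤ *_) (setRow-same k rest M c)) (ℤP.*-identityˡ (rest c)))))) ⟩
    μ zero * det n (setRow k (w zero) M) + 1ℤ * det n (setRow k rest M)
  ≡⟨ cong (μ zero * det n (setRow k (w zero) M) +_)
          (trans (ℤP.*-identityˡ _) (det-setRow-linear n t k (μ ∘ suc) (w ∘ suc) M)) ⟩
    sumFin (suc t) (λ a → μ a * det n (setRow k (w a) M))
  ∎
  where
  open ≡-Reasoning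
  rest : Fin n → ℤ
  rest c = sumFin t (λ a → μ (suc a) * w (suc a) c)

-- By linearity in row k, the added combination contributes determinants with two equal rows.
det-addEarlierRows : ∀ n (k : Fin n) (μ : Fin n → ℤ) (M P : Matrix n) →
  (∀ a → toℕ k ≤ toℕ a → μ a ≡ 0ℤ) →
  (∀ r → r ≢ k → ∀ c → P r c ≡ M r c) → (∀ c → P k c ≡ M k c + sumFin n (λ a → μ a * M a c)) →
  det n P ≡ det n M
det-addEarlierRows n k μ M P μ-lower P≗M Pₖ = begin
    det n P
  ≡⟨ det-linearInRow n k 1ℤ 1ℤ M N P P≗M (setRow-other k _ M)
       (λ c → trans (Pₖ c) (sym (cong₂ _+_ (ℤP.*-identityˡ (M k c)) (trans (ℤP.*-identityˡ _) (setRow-same k _ M c))))) ⟩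
    1ℤ * det n M + 1ℤ * det n N
  ≡⟨ cong₂ _+_ (ℤP.*-identityˡ (det n M)) (trans (ℤP.*-identityˡ (det n N)) det-N) ⟩
    det n M + 0ℤ
  ≡⟨ ℤP.+-identityʳ (det n M) ⟩
    det n M
  ∎
  where
  open ≡-Reasoning
  N = setRow k (λ c → sumFin n (λ a → μ a * M a c)) M
  term : ∀ a → μ a * det n (setRow k (M a) M) ≡ 0ℤ
  term a with toℕ k ≤? toℕ a
  ... | yes k≤a = cong (_* det n (setRow k (M a) M)) (μ-lower a k≤a)
  ... | no  k≰a = trans (cong (μ a *_) equalRows) (ℤP.*-zeroʳ (μ a))
    where
    a<k : toℕ a < toℕ k
    a<k = ℕP.≰⇒> k≰a
    equalRows : det n (setRow k (M a) M) ≡ 0ℤ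
    equalRows = det-equalRows n (setRow k (M a) M) a<k
      (λ c → trans (setRow-other k _ M a (λ a≡k → ℕP.<⇒≢ a<k (cong toℕ a≡k)) c) (sym (setRow-same k _ M c)))
  det-N : det n N ≡ 0ℤ
  det-N = trans (det-setRow-linear n n k μ M M) (trans (sumFin-cong n term) (sumFin-0 n))

spliceRows : ∀ {n} → ℕ → Matrix n → Matrix n → Matrix n
spliceRows t C X r c with toℕ r <? t
... | yes _ = C r c
... | no _  = X r c

spliceRows-< : ∀ {n} t (C X : Matrix n) r c → toℕ r < t → spliceRows t C X r c ≡ C r c
spliceRows-< t C X r c r<t with toℕ r <? t
... | yes _  = refl
... | no r≮t = ⊥-elim (r≮t r<t)

spliceRows-≮ : ∀ {n} t (C X : Matrix n) r c → ¬ toℕ r < t → spliceRows t C X r c ≡ X r c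
spliceRows-≮ t C X r c r≮t with toℕ r <? t
... | yes r<t = ⊥-elim (r≮t r<t)
... | no _    = refl

det-lowerUnitriangular* : ∀ n (C X : Matrix n) (μ : Fin n → Fin n → ℤ) →
  (∀ i a → toℕ i ≤ toℕ a → μ i a ≡ 0ℤ) →
  (∀ i c → X i c ≡ C i c + sumFin n (λ a → μ i a * C a c)) → det n X ≡ det n C
det-lowerUnitriangular* n C X μ μ-lower X≡ =
  trans (det-cong n (λ r c → sym (spliceRows-≮ 0 C X r c (λ ()))))
        (trans (fromRow 0 n refl) (det-cong n (λ r c → spliceRows-< n C X r c (FinP.toℕ<n r))))
  where
  -- S t and S (1 + t) differ only in row t, where X adds to C a combination of rows
  -- already taken from C.
  S : ℕ → Matrix n
  S t = spliceRows t C X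
  step : ∀ t → (t<n : t < n) → det n (S t) ≡ det n (S (suc t))
  step t t<n = det-addEarlierRows n k (μ k) (S (suc t)) (S t) (μ-lower k) others rowₖ
    where
    k = fromℕ< t<n
    k≡t : toℕ k ≡ t
    k≡t = FinP.toℕ-fromℕ< t<n
    others : ∀ r → r ≢ k → ∀ c → S t r c ≡ S (suc t) r c
    others r r≢k c with toℕ r <? t
    ... | yes r<t = sym (spliceRows-< (suc t) C X r c (ℕP.m<n⇒m<1+n r<t))
    ... | no r≮t  = sym (spliceRows-≮ (suc t) C X r c λ r<1+t →
                     r≢k (FinP.toℕ-injective (trans (ℕP.≤-antisym (ℕP.≤-pred r<1+t) (ℕP.≮⇒≥ r≮t)) (sym k≡t))))
    rowₖ : ∀ c → S t k c ≡ S (suc t) k c + sumFin n (λ a → μ k a * S (suc t) a c)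
    rowₖ c = trans (spliceRows-≮ t C X k c (ℕP.<-irrefl k≡t))
               (trans (X≡ k c) (cong₂ _+_ (sym (spliceRows-< (suc t) C X k c (ℕP.≤-reflexive (cong suc k≡t))))
                                          (sumFin-cong n termₐ)))
      where
      termₐ : ∀ a → μ k a * C a c ≡ μ k a * S (suc t) a c
      termₐ a with toℕ k ≤? toℕ a
      ... | yes k≤a = trans (cong (_* C a c) (μ-lower k a k≤a)) (cong (_* S (suc t) a c) (sym (μ-lower k a k≤a)))
      ... | no k≰a  = cong (μ k a *_) (sym (spliceRows-< (suc t) C X a c
                        (ℕP.m<n⇒m<1+n (subst (toℕ a <_) k≡t (ℕP.≰⇒> k≰a)))))
  fromRow : ∀ t s → t ℕ.+ s ≡ n → det n (S t) ≡ det n (S n)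
  fromRow t zero    t+0≡n = cong (det n ∘ S) (trans (sym (ℕP.+-identityʳ t)) t+0≡n)
  fromRow t (suc s) t+s≡n =
    trans (step t (subst (t <_) t+s≡n (ℕP.m<m+n t ℕ.z<s)))
          (fromRow (suc t) s (trans (sym (ℕP.+-suc t s)) t+s≡n))

-- Coefficient sequences and their convolution

sumBelow : ℕ → (ℕ → ℤ) → ℤ
sumBelow zero    h = 0ℤ
sumBelow (suc i) h = h 0 + sumBelow i (h ∘ suc)

sumBelow-cong : ∀ i {h h′ : ℕ → ℤ} → (∀ a → a < i → h a ≡ h′ a) → sumBelow i h ≡ sumBelow i h′
sumBelow-cong zero    h≗h′ = refl
sumBelow-cong (suc i) h≗h′ = cong₂ _+_ (h≗h′ 0 ℕ.z<s) (sumBelow-cong i (λ a a<i → h≗h′ (suc a) (s≤s a<i)))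

neg-distrib-sumBelow : ∀ i h → - sumBelow i h ≡ sumBelow i (λ a → - h a)
neg-distrib-sumBelow zero    h = refl
neg-distrib-sumBelow (suc i) h = trans (ℤP.neg-distrib-+ (h 0) _) (cong (- h 0 +_) (neg-distrib-sumBelow i (h ∘ suc)))

sumBelow-0 : ∀ i → sumBelow i (λ _ → 0ℤ) ≡ 0ℤ
sumBelow-0 zero    = refl
sumBelow-0 (suc i) = trans (ℤP.+-identityˡ _) (sumBelow-0 i)

sumBelow-last : ∀ i h → sumBelow (suc i) h ≡ sumBelow i h + h i
sumBelow-last zero    h = trans (ℤP.+-identityʳ (h 0)) (sym (ℤP.+-identityˡ (h 0)))
sumBelow-last (suc i) h = trans (cong (h 0 +_) (sumBelow-last i (h ∘ suc))) (sym (ℤP.+-assoc (h 0) _ _))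

sumFin-sumBelow : ∀ n h → sumFin n (h ∘ toℕ) ≡ sumBelow n h
sumFin-sumBelow zero    h = refl
sumFin-sumBelow (suc n) h = cong (h 0 +_) (sumFin-sumBelow n (h ∘ suc))

sumBelow-truncate : ∀ n i (h y : ℕ → ℤ) → i ≤ n →
  sumBelow n (λ a → (if a <ᵇ i then h a else 0ℤ) * y a) ≡ sumBelow i (λ a → h a * y a)
sumBelow-truncate n       zero    h y _         = sumBelow-0 n
sumBelow-truncate (suc n) (suc i) h y (s≤s i≤n) = cong (h 0 * y 0 +_) (sumBelow-truncate n i (h ∘ suc) (y ∘ suc) i≤n)

sumBelow-reverse : ∀ i (h : ℕ → ℤ) → sumBelow i h ≡ sumBelow i (λ t → h (i ∸ suc t))
sumBelow-reverse zero    h = refl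
sumBelow-reverse (suc i) h = begin
    h 0 + sumBelow i (h ∘ suc)
  ≡⟨ cong (h 0 +_) (sumBelow-reverse i (h ∘ suc)) ⟩
    h 0 + sumBelow i (λ t → h (suc (i ∸ suc t)))
  ≡⟨ ℤP.+-comm (h 0) _ ⟩
    sumBelow i (λ t → h (suc (i ∸ suc t))) + h 0
  ≡⟨ cong₂ _+_ (sumBelow-cong i (λ t t<i → cong h (sym (ℕP.+-∸-assoc 1 t<i)))) (cong h (sym (ℕP.n∸n≡0 i))) ⟩
    sumBelow i (λ t → h (i ∸ t)) + h (i ∸ i)
  ≡⟨ sym (sumBelow-last i (λ t → h (i ∸ t))) ⟩
    sumBelow (suc i) (λ t → h (suc i ∸ suc t))
  ∎
  where open ≡-Reasoning

conv : (ℕ → ℤ) → (ℕ → ℤ) → ℕ → ℤ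
conv u v zero    = u 0 * v 0
conv u v (suc N) = u 0 * v (suc N) + conv (u ∘ suc) v N

conv-cong≤ : ∀ N {u u′ v v′ : ℕ → ℤ} → (∀ k → k ≤ N → u k ≡ u′ k) → (∀ k → k ≤ N → v k ≡ v′ k) →
             conv u v N ≡ conv u′ v′ N
conv-cong≤ zero    u≗u′ v≗v′ = cong₂ _*_ (u≗u′ 0 z≤n) (v≗v′ 0 z≤n)
conv-cong≤ (suc N) u≗u′ v≗v′ = cong₂ _+_ (cong₂ _*_ (u≗u′ 0 z≤n) (v≗v′ (suc N) ℕP.≤-refl))
  (conv-cong≤ N (λ k k≤N → u≗u′ (suc k) (s≤s k≤N)) (λ k k≤N → v≗v′ k (ℕP.m≤n⇒m≤1+n k≤N)))

conv-cong : ∀ N {u u′ v v′ : ℕ → ℤ} → (∀ k → u k ≡ u′ k) → (∀ k → v k ≡ v′ k) → conv u v N ≡ conv u′ v′ N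
conv-cong N u≗u′ v≗v′ = conv-cong≤ N (λ k _ → u≗u′ k) (λ k _ → v≗v′ k)

conv-sucʳ : ∀ N u v → conv u v (suc N) ≡ conv u (v ∘ suc) N + u (suc N) * v 0
conv-sucʳ zero    u v = refl
conv-sucʳ (suc N) u v = trans (cong (u 0 * v (suc (suc N)) +_) (conv-sucʳ N (u ∘ suc) v))
                              (sym (ℤP.+-assoc (u 0 * v (suc (suc N))) _ _))

conv-comm : ∀ N u v → conv u v N ≡ conv v u N
conv-comm zero    u v = ℤP.*-comm (u 0) (v 0)
conv-comm (suc N) u v = begin
    u 0 * v (suc N) + conv (u ∘ suc) v N
  ≡⟨ cong₂ _+_ (ℤP.*-comm (u 0) (v (suc N))) (conv-comm N (u ∘ suc) v) ⟩
    v (suc N) * u 0 + conv v (u ∘ suc) N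
  ≡⟨ ℤP.+-comm (v (suc N) * u 0) _ ⟩
    conv v (u ∘ suc) N + v (suc N) * u 0
  ≡⟨ sym (conv-sucʳ N v u) ⟩
    conv v u (suc N)
  ∎
  where open ≡-Reasoning

conv-distribʳ-+ : ∀ N u w v → conv (λ k → u k + w k) v N ≡ conv u v N + conv w v N
conv-distribʳ-+ zero    u w v = ℤP.*-distribʳ-+ (v 0) (u 0) (w 0)
conv-distribʳ-+ (suc N) u w v =
  trans (cong ((u 0 + w 0) * v (suc N) +_) (conv-distribʳ-+ N (u ∘ suc) (w ∘ suc) v))
        (interchange (u 0) (w 0) (v (suc N)) _ _)
  where
  interchange : ∀ a b c x y → (a + b) * c + (x + y) ≡ (a * c + x) + (b * c + y)
  interchange = solve-∀

conv-*ˡ : ∀ N a u v → conv (λ k → a * u k) v N ≡ a * conv u v N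
conv-*ˡ zero    a u v = ℤP.*-assoc a (u 0) (v 0)
conv-*ˡ (suc N) a u v =
  trans (cong₂ _+_ (ℤP.*-assoc a (u 0) (v (suc N))) (conv-*ˡ N a (u ∘ suc) v))
        (sym (ℤP.*-distribˡ-+ a _ _))

conv-assoc : ∀ N u v w → conv (conv u v) w N ≡ conv u (conv v w) N
conv-assoc zero    u v w = ℤP.*-assoc (u 0) (v 0) (w 0)
conv-assoc (suc N) u v w = begin
    u 0 * v 0 * w (suc N) + conv (λ k → u 0 * v (suc k) + conv (u ∘ suc) v k) w N
  ≡⟨ cong (u 0 * v 0 * w (suc N) +_) (conv-distribʳ-+ N (λ k → u 0 * v (suc k)) (conv (u ∘ suc) v) w) ⟩
    u 0 * v 0 * w (suc N) + (conv (λ k → u 0 * v (suc k)) w N + conv (conv (u ∘ suc) v) w N)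
  ≡⟨ cong₂ (λ x y → u 0 * v 0 * w (suc N) + (x + y)) (conv-*ˡ N (u 0) (v ∘ suc) w) (conv-assoc N (u ∘ suc) v w) ⟩
    u 0 * v 0 * w (suc N) + (u 0 * conv (v ∘ suc) w N + conv (u ∘ suc) (conv v w) N)
  ≡⟨ regroup (u 0) (v 0) (w (suc N)) _ _ ⟩
    u 0 * (v 0 * w (suc N) + conv (v ∘ suc) w N) + conv (u ∘ suc) (conv v w) N
  ∎
  where
  open ≡-Reasoning
  regroup : ∀ a b c x y → a * b * c + (a * x + y) ≡ a * (b * c + x) + y
  regroup = solve-∀

conv-shiftˡ : ∀ L w u v → u 0 ≡ 0ℤ → conv w (conv u v) (suc L) ≡ conv (conv w (λ k → u (suc k))) v L
conv-shiftˡ L w u v u₀ = begin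
    conv w (conv u v) (suc L)
  ≡⟨ conv-sucʳ L w (conv u v) ⟩
    conv w (λ k → u 0 * v (suc k) + conv (λ k → u (suc k)) v k) L + w (suc L) * (u 0 * v 0)
  ≡⟨ cong₂ _+_ (conv-cong L (λ _ → refl) (λ k → trans (cong (λ x → x * v (suc k) + conv (λ i → u (suc i)) v k) u₀)
                                                      (ℤP.+-identityˡ _)))
               (trans (cong (λ x → w (suc L) * (x * v 0)) u₀) (ℤP.*-zeroʳ (w (suc L)))) ⟩
    conv w (conv (λ k → u (suc k)) v) L + 0ℤ
  ≡⟨ ℤP.+-identityʳ _ ⟩
    conv w (conv (λ k → u (suc k)) v) L
  ≡⟨ sym (conv-assoc L w (λ k → u (suc k)) v) ⟩
    conv (conv w (λ k → u (suc k))) v L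
  ∎
  where open ≡-Reasoning

conv-sumBelow : ∀ N u v → conv u v N ≡ sumBelow (suc N) (λ k → u k * v (N ∸ k))
conv-sumBelow zero    u v = sym (ℤP.+-identityʳ (u 0 * v 0))
conv-sumBelow (suc N) u v = cong (u 0 * v (suc N) +_) (conv-sumBelow N (u ∘ suc) v)

conv-split : ∀ i j u v →
  conv u v (i ℕ.+ j) ≡ sumBelow i (λ t → u t * v (suc (i ∸ suc t ℕ.+ j))) + conv (λ c → u (i ℕ.+ c)) v j
conv-split zero    j u v = sym (ℤP.+-identityˡ _)
conv-split (suc i) j u v = trans (cong (u 0 * v (suc (i ℕ.+ j)) +_) (conv-split i j (u ∘ suc) v))
                                 (sym (ℤP.+-assoc (u 0 * v (suc (i ℕ.+ j))) _ _))

-- Hankel determinants of the solution of F = 1 + x G F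

private
  module HankelRecurrence (f g : ℕ → ℤ) (f₀ : f 0 ≡ 1ℤ) (f-rec : ∀ N → f (suc N) ≡ conv g f N) where

    C : ℕ → ℕ → ℤ
    C i j = conv (λ c → g (i ℕ.+ c)) f j

    reduction : ℕ → (ℕ → ℤ) → ℤ
    reduction i y = sumBelow i (λ a → - g (i ∸ suc a) * y a)

    reduction-reverse : ∀ i y → reduction i y ≡ - sumBelow i (λ t → g t * y (i ∸ suc t))
    reduction-reverse i y = begin
        sumBelow i (λ a → - g (i ∸ suc a) * y a)
      ≡⟨ sumBelow-cong i (λ a _ → sym (ℤP.neg-distribˡ-* (g (i ∸ suc a)) (y a))) ⟩
        sumBelow i (λ a → - (g (i ∸ suc a) * y a))
      ≡⟨ sym (neg-distrib-sumBelow i (λ a → g (i ∸ suc a) * y a)) ⟩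
        - sumBelow i (λ a → g (i ∸ suc a) * y a)
      ≡⟨ cong -_ (sumBelow-reverse i (λ a → g (i ∸ suc a) * y a)) ⟩
        - sumBelow i (λ t → g (i ∸ suc (i ∸ suc t)) * y (i ∸ suc t))
      ≡⟨ cong -_ (sumBelow-cong i (λ t t<i → cong (λ x → g x * y (i ∸ suc t)) (i∸[i∸[1+t]+1]≡t t<i))) ⟩
        - sumBelow i (λ t → g t * y (i ∸ suc t))
      ∎
      where
      open ≡-Reasoning
      i∸[i∸[1+t]+1]≡t : ∀ {t} → t < i → i ∸ suc (i ∸ suc t) ≡ t
      i∸[i∸[1+t]+1]≡t t<i = trans (cong (i ∸_) (sym (ℕP.+-∸-assoc 1 t<i))) (ℕP.m∸[m∸n]≡n (ℕP.<⇒≤ t<i))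

    C≡reduced-f : ∀ i j → C i j ≡ f (suc (i ℕ.+ j)) + reduction i (λ a → f (suc (a ℕ.+ j)))
    C≡reduced-f i j = sym (begin
        f (suc (i ℕ.+ j)) + reduction i (λ a → f (suc (a ℕ.+ j)))
      ≡⟨ cong₂ _+_ (trans (f-rec (i ℕ.+ j)) (conv-split i j g f)) (reduction-reverse i (λ a → f (suc (a ℕ.+ j)))) ⟩
        (s + C i j) + - s
      ≡⟨ cancel s (C i j) ⟩
        C i j
      ∎)
      where
      open ≡-Reasoning
      s = sumBelow i (λ t → g t * f (suc (i ∸ suc t ℕ.+ j)))
      cancel : ∀ s c → (s + c) + - s ≡ c
      cancel = solve-∀

    -- G · x^{-j} (G - G_{<j}) F = x^{-j} (G - G_{<j}) · G F, and G F = (F - 1) / x.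
    conv-C-g : ∀ i j → conv (C j) g i ≡ conv (λ c → g (j ℕ.+ c)) (f ∘ suc) i
    conv-C-g i j = begin
        conv (C j) g i                       ≡⟨ conv-comm i (C j) g ⟩
        conv g (conv gⱼ f) i                 ≡⟨ sym (conv-assoc i g gⱼ f) ⟩
        conv (conv g gⱼ) f i                 ≡⟨ conv-cong i (λ k → conv-comm k g gⱼ) (λ _ → refl) ⟩
        conv (conv gⱼ g) f i                 ≡⟨ conv-assoc i gⱼ g f ⟩
        conv gⱼ (conv g f) i                 ≡⟨ conv-cong i (λ _ → refl) (sym ∘ f-rec) ⟩
        conv gⱼ (f ∘ suc) i                  ∎
      where
      open ≡-Reasoning
      gⱼ : ℕ → ℤ
      gⱼ c = g (j ℕ.+ c)

    g≡reduced-Cᵀ : ∀ i j → g (i ℕ.+ j) ≡ C j i + reduction i (C j)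
    g≡reduced-Cᵀ zero    j = sym (begin
        g (j ℕ.+ 0) * f 0 + 0ℤ    ≡⟨ ℤP.+-identityʳ _ ⟩
        g (j ℕ.+ 0) * f 0         ≡⟨ cong (g (j ℕ.+ 0) *_) f₀ ⟩
        g (j ℕ.+ 0) * 1ℤ          ≡⟨ ℤP.*-identityʳ _ ⟩
        g (j ℕ.+ 0)               ≡⟨ cong g (ℕP.+-identityʳ j) ⟩
        g j                       ∎)
      where open ≡-Reasoning
    g≡reduced-Cᵀ (suc i) j = sym (begin
        C j (suc i) + reduction (suc i) (C j)
      ≡⟨ cong (C j (suc i) +_) (reduction-reverse (suc i) (C j)) ⟩
        C j (suc i) + - sumBelow (suc i) (λ t → g t * C j (i ∸ t))
      ≡⟨ cong (λ x → C j (suc i) + - x) (trans (sym (conv-sumBelow i g (C j))) (trans (conv-comm i g (C j)) (conv-C-g i j))) ⟩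
        C j (suc i) + - conv gⱼ (f ∘ suc) i
      ≡⟨ cong (_+ - conv gⱼ (f ∘ suc) i) (conv-sucʳ i gⱼ f) ⟩
        (conv gⱼ (f ∘ suc) i + gⱼ (suc i) * f 0) + - conv gⱼ (f ∘ suc) i
      ≡⟨ cancel (conv gⱼ (f ∘ suc) i) (gⱼ (suc i) * f 0) ⟩
        gⱼ (suc i) * f 0
      ≡⟨ trans (cong (gⱼ (suc i) *_) f₀) (ℤP.*-identityʳ _) ⟩
        g (j ℕ.+ suc i)
      ≡⟨ cong g (ℕP.+-comm j (suc i)) ⟩
        g (suc i ℕ.+ j)
      ∎)
      where
      open ≡-Reasoning
      gⱼ : ℕ → ℤ
      gⱼ c = g (j ℕ.+ c)
      cancel : ∀ x y → (x + y) + - x ≡ y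
      cancel = solve-∀

    μ : ∀ {n} → Fin n → Fin n → ℤ
    μ i a = if toℕ a <ᵇ toℕ i then - g (toℕ i ∸ suc (toℕ a)) else 0ℤ

    μ-lower : ∀ {n} (i a : Fin n) → toℕ i ≤ toℕ a → μ i a ≡ 0ℤ
    μ-lower i a i≤a with toℕ a <ᵇ toℕ i in a<ᵇi
    ... | false = refl
    ... | true  = ⊥-elim (ℕP.≤⇒≯ i≤a (ℕP.<ᵇ⇒< (toℕ a) (toℕ i) (subst T (sym a<ᵇi) _)))

    μ-reduction : ∀ n (i : Fin n) (y : ℕ → ℤ) → sumFin n (λ a → μ i a * y (toℕ a)) ≡ reduction (toℕ i) y
    μ-reduction n i y =
      trans (sumFin-sumBelow n (λ a → (if a <ᵇ toℕ i then - g (toℕ i ∸ suc a) else 0ℤ) * y a))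
            (sumBelow-truncate n (toℕ i) (λ a → - g (toℕ i ∸ suc a)) y (ℕP.<⇒≤ (FinP.toℕ<n i)))

    hankel₁≡det-C : ∀ n → hankel 1 n f ≡ det n (λ i j → C (toℕ i) (toℕ j))
    hankel₁≡det-C n = sym (det-lowerUnitriangular* n (λ i j → f (1 ℕ.+ toℕ i ℕ.+ toℕ j)) _ μ μ-lower
      (λ i c → trans (C≡reduced-f (toℕ i) (toℕ c)) (cong (f (suc (toℕ i ℕ.+ toℕ c)) +_)
                                                         (sym (μ-reduction n i (λ a → f (suc (a ℕ.+ toℕ c))))))))

    hankel₀≡det-Cᵀ : ∀ n → hankel 0 n g ≡ det n (λ i j → C (toℕ j) (toℕ i))
    hankel₀≡det-Cᵀ n = det-lowerUnitriangular* n (λ i j → C (toℕ j) (toℕ i)) _ μ μ-lower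
      (λ i c → trans (g≡reduced-Cᵀ (toℕ i) (toℕ c)) (cong (C (toℕ c) (toℕ i) +_) (sym (μ-reduction n i (C (toℕ c))))))

hankel-recurrence : (f g : ℕ → ℤ) → f 0 ≡ 1ℤ → (∀ N → f (suc N) ≡ conv g f N) →
                    ∀ n → hankel 1 n f ≡ hankel 0 n g
hankel-recurrence f g f₀ f-rec n = begin
    hankel 1 n f                           ≡⟨ hankel₁≡det-C n ⟩
    det n (λ i j → C (toℕ i) (toℕ j))      ≡⟨ sym (det-transpose n (λ i j → C (toℕ i) (toℕ j))) ⟩
    det n (λ i j → C (toℕ j) (toℕ i))      ≡⟨ sym (hankel₀≡det-Cᵀ n) ⟩
    hankel 0 n g                           ∎
  where
  open ≡-Reasoning
  open HankelRecurrence f g f₀ f-rec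

conv-odd : ∀ N (u v : ℕ → ℤ) → (∀ j → u (2 ℕ.* j) ≡ 0ℤ) → (∀ k → v (suc (2 ℕ.* k)) ≡ 0ℤ) →
           conv u v (suc (2 ℕ.* N)) ≡ conv (λ j → u (suc (2 ℕ.* j))) (λ k → v (2 ℕ.* k)) N
conv-odd zero    u v u-even v-odd = trans (cong (λ x → x * v 1 + u 1 * v 0) (u-even 0)) (ℤP.+-identityˡ (u 1 * v 0))
conv-odd (suc N) u v u-even v-odd = begin
    conv u v (suc (2 ℕ.* suc N))
  ≡⟨ cong (λ x → conv u v (suc x)) (ℕP.*-suc 2 N) ⟩
    u 0 * v (3 ℕ.+ 2 ℕ.* N) + (u 1 * v (2 ℕ.+ 2 ℕ.* N) + conv u₂ v (suc (2 ℕ.* N)))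
  ≡⟨ cong (λ x → x * v (3 ℕ.+ 2 ℕ.* N) + (u 1 * v (2 ℕ.+ 2 ℕ.* N) + conv u₂ v (suc (2 ℕ.* N)))) (u-even 0) ⟩
    0ℤ + (u 1 * v (2 ℕ.+ 2 ℕ.* N) + conv u₂ v (suc (2 ℕ.* N)))
  ≡⟨ ℤP.+-identityˡ _ ⟩
    u 1 * v (2 ℕ.+ 2 ℕ.* N) + conv u₂ v (suc (2 ℕ.* N))
  ≡⟨ cong₂ _+_ (cong (λ x → u 1 * v x) (sym (ℕP.*-suc 2 N)))
       (trans (conv-odd N u₂ v (λ j → trans (cong u (sym (ℕP.*-suc 2 j))) (u-even (suc j))) v-odd)
              (conv-cong N (λ j → cong (λ k → u (suc k)) (sym (ℕP.*-suc 2 j))) (λ _ → refl))) ⟩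
    u 1 * v (2 ℕ.* suc N) + conv (λ j → u (suc (2 ℕ.* suc j))) (λ k → v (2 ℕ.* k)) N
  ∎
  where
  open ≡-Reasoning
  u₂ : ℕ → ℤ
  u₂ k = u (suc (suc k))

-- Counting Dyck walks

countᵇ : {A : Set} → (A → Bool) → List A → ℕ
countᵇ b []       = 0
countᵇ b (x ∷ xs) = if b x then suc (countᵇ b xs) else countᵇ b xs

length-filter-T? : {A : Set} (b : A → Bool) (xs : List A) → length (filter (T? ∘ b) xs) ≡ countᵇ b xs
length-filter-T? b []       = refl
length-filter-T? b (x ∷ xs) with b x
... | true  = cong suc (length-filter-T? b xs)
... | false = length-filter-T? b xs

countᵇ-++ : {A : Set} (b : A → Bool) (xs ys : List A) → countᵇ b (xs ++ ys) ≡ countᵇ b xs ℕ.+ countᵇ b ys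
countᵇ-++ b []       ys = refl
countᵇ-++ b (x ∷ xs) ys with b x
... | true  = cong suc (countᵇ-++ b xs ys)
... | false = countᵇ-++ b xs ys

countᵇ-map : {A B : Set} (b : B → Bool) (f : A → B) (xs : List A) → countᵇ b (map f xs) ≡ countᵇ (b ∘ f) xs
countᵇ-map b f []       = refl
countᵇ-map b f (x ∷ xs) with b (f x)
... | true  = cong suc (countᵇ-map b f xs)
... | false = countᵇ-map b f xs

countᵇ-cong : {A : Set} {b b′ : A → Bool} (xs : List A) → (∀ x → b x ≡ b′ x) → countᵇ b xs ≡ countᵇ b′ xs
countᵇ-cong []       b≗b′ = refl
countᵇ-cong (x ∷ xs) b≗b′ = cong₂ (λ c n → if c then suc n else n) (b≗b′ x) (countᵇ-cong xs b≗b′)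

countᵇ-false : {A : Set} (xs : List A) → countᵇ (λ _ → false) xs ≡ 0
countᵇ-false []       = refl
countᵇ-false (x ∷ xs) = countᵇ-false xs

-- up records that the previous step was an up-step, so that a down-step now closes a peak at h.
peaksAvoidAfter : (ℕ → Bool) → ℕ → Bool → List Bool → Bool
peaksAvoidAfter bad h up []          = true
peaksAvoidAfter bad h up (true ∷ s)  = peaksAvoidAfter bad (suc h) true s
peaksAvoidAfter bad h up (false ∷ s) = not (up ∧ bad h) ∧ peaksAvoidAfter bad (h ∸ 1) false s

mutual
  peaksAvoid≡peaksAvoidAfter : ∀ bad h s → peaksAvoid bad h s ≡ peaksAvoidAfter bad h false s
  peaksAvoid≡peaksAvoidAfter bad h []          = refl
  peaksAvoid≡peaksAvoidAfter bad h (true ∷ s)  = peaksAvoid-up bad h s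
  peaksAvoid≡peaksAvoidAfter bad h (false ∷ s) = peaksAvoid≡peaksAvoidAfter bad (h ∸ 1) s

  peaksAvoid-up : ∀ bad h s → peaksAvoid bad h (true ∷ s) ≡ peaksAvoidAfter bad (suc h) true s
  peaksAvoid-up bad h []          = refl
  peaksAvoid-up bad h (true ∷ s)  = peaksAvoid-up bad (suc h) s
  peaksAvoid-up bad h (false ∷ s) = cong (not (bad (suc h)) ∧_) (peaksAvoid≡peaksAvoidAfter bad h s)

mutual
  walks : (ℕ → Bool) → ℕ → Bool → ℕ → ℤ
  walks bad h up zero    = if h ≡ᵇ 0 then 1ℤ else 0ℤ
  walks bad h up (suc L) = walks bad (suc h) true L + walksDown bad h up L

  walksDown : (ℕ → Bool) → ℕ → Bool → ℕ → ℤ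
  walksDown bad zero    up L = 0ℤ
  walksDown bad (suc h) up L = if up ∧ bad (suc h) then 0ℤ else walks bad h false L

walks-count : ∀ bad L h up →
  ℤ.+ countᵇ (λ p → isDyckFrom h p ∧ peaksAvoidAfter bad h up p) (allPaths L) ≡ walks bad h up L
walks-count bad zero h up with h ≡ᵇ 0
... | true  = refl
... | false = refl
walks-count bad (suc L) h up = begin
    ℤ.+ countᵇ (valid h up) (map (true ∷_) (allPaths L) ++ map (false ∷_) (allPaths L))
  ≡⟨ cong ℤ.+_ (trans (countᵇ-++ (valid h up) (map (true ∷_) (allPaths L)) (map (false ∷_) (allPaths L)))
                      (cong₂ ℕ._+_ (countᵇ-map (valid h up) (true ∷_) (allPaths L))
                                   (countᵇ-map (valid h up) (false ∷_) (allPaths L)))) ⟩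
    ℤ.+ (countᵇ (valid (suc h) true) (allPaths L) ℕ.+ countᵇ (valid h up ∘ (false ∷_)) (allPaths L))
  ≡⟨ ℤP.pos-+ (countᵇ (valid (suc h) true) (allPaths L)) _ ⟩
    ℤ.+ countᵇ (valid (suc h) true) (allPaths L) + ℤ.+ countᵇ (valid h up ∘ (false ∷_)) (allPaths L)
  ≡⟨ cong₂ _+_ (walks-count bad L (suc h) true) (down h up) ⟩
    walks bad (suc h) true L + walksDown bad h up L
  ∎
  where
  open ≡-Reasoning
  valid : ℕ → Bool → List Bool → Bool
  valid h up p = isDyckFrom h p ∧ peaksAvoidAfter bad h up p
  down : ∀ h up → ℤ.+ countᵇ (valid h up ∘ (false ∷_)) (allPaths L) ≡ walksDown bad h up L
  down zero    up = cong ℤ.+_ (countᵇ-false (allPaths L))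
  down (suc h) up with up ∧ bad (suc h)
  ... | true  = cong ℤ.+_ (trans (countᵇ-cong (allPaths L) (λ p → BoolP.∧-zeroʳ (isDyckFrom h p)))
                                (countᵇ-false (allPaths L)))
  ... | false = walks-count bad L h false

D≡walks : ∀ m .{{_ : NonZero m}} V k → D m V k ≡ walks (inClass m V) 0 false (2 ℕ.* k)
D≡walks m V k = trans
  (cong ℤ.+_ (trans (length-filter-T? _ (allPaths (2 ℕ.* k)))
                    (countᵇ-cong (allPaths (2 ℕ.* k))
                                 (λ p → cong (isDyckFrom 0 p ∧_) (peaksAvoid≡peaksAvoidAfter (inClass m V) 0 p)))))
  (walks-count (inClass m V) (2 ℕ.* k) 0 false)

walks-cong : ∀ {bad bad′ : ℕ → Bool} → (∀ x → bad (suc x) ≡ bad′ (suc x)) →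
             ∀ L h up → walks bad h up L ≡ walks bad′ h up L
walks-cong bad≗bad′ zero    h up = refl
walks-cong {bad} {bad′} bad≗bad′ (suc L) h up = cong₂ _+_ (walks-cong bad≗bad′ L (suc h) true) (down h up)
  where
  down : ∀ h up → walksDown bad h up L ≡ walksDown bad′ h up L
  down zero    up = refl
  down (suc h) up = cong₂ (λ b w → if up ∧ b then 0ℤ else w) (bad≗bad′ h) (walks-cong bad≗bad′ L h false)

isEven : ℕ → Bool
isEven zero    = true
isEven (suc n) = not (isEven n)

isEven-double : ∀ k → isEven (2 ℕ.* k) ≡ true
isEven-double zero    = refl
isEven-double (suc k) = trans (cong isEven (ℕP.*-suc 2 k)) (trans (BoolP.not-involutive (isEven (2 ℕ.* k))) (isEven-double k))

walks-parity : ∀ bad L h up → isEven (L ℕ.+ h) ≡ false → walks bad h up L ≡ 0ℤ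
walks-parity bad zero    zero    up ()
walks-parity bad zero    (suc h) up _ = refl
walks-parity bad (suc L) h up odd =
  cong₂ _+_ (walks-parity bad L (suc h) true (trans (cong isEven (ℕP.+-suc L h)) odd)) (down h up odd)
  where
  down : ∀ h up → isEven (suc (L ℕ.+ h)) ≡ false → walksDown bad h up L ≡ 0ℤ
  down zero    up _ = refl
  down (suc h) up odd with up ∧ bad (suc h)
  ... | true  = refl
  ... | false = walks-parity bad L h false
                  (trans (sym (BoolP.not-involutive (isEven (L ℕ.+ h)))) (trans (cong (isEven ∘ suc) (sym (ℕP.+-suc L h))) odd))

shiftBad : ℕ → (ℕ → Bool) → ℕ → Bool
shiftBad k bad x = bad (k ℕ.+ x)

-- firstDescent bad h up L counts the walks of length L from height h + 1 that reach height h
-- for the first time at their last step.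
firstDescent : (ℕ → Bool) → ℕ → Bool → ℕ → ℤ
firstDescent bad h up zero          = 0ℤ
firstDescent bad h up (suc zero)    = if up ∧ bad (suc h) then 0ℤ else 1ℤ
firstDescent bad h up (suc (suc L)) = walks (shiftBad (suc h) bad) 0 up (suc L)

firstDescent-shiftBad : ∀ bad h L → firstDescent (shiftBad (suc h) bad) 0 true L ≡ firstDescent bad (suc h) true L
firstDescent-shiftBad bad h zero          = refl
firstDescent-shiftBad bad h (suc zero)    = cong (λ x → if bad x then 0ℤ else 1ℤ) (ℕP.+-comm (suc h) 1)
firstDescent-shiftBad bad h (suc (suc L)) = walks-cong (λ x → cong bad (ℕP.+-suc (suc h) (suc x))) (suc L) 0 true

walks-shiftBad : ∀ bad h L → walks (shiftBad (suc h) bad) 0 false L ≡ firstDescent bad h false (suc L)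
walks-shiftBad bad h zero    = refl
walks-shiftBad bad h (suc L) = refl

FirstDescentDecomposition : ℕ → Set
FirstDescentDecomposition L =
  ∀ bad h up → walks bad (suc h) up L ≡ conv (firstDescent bad h up) (walks bad h false) L

-- A walk from h + 1 that starts with an up-step is cut twice by the induction hypothesis, at its
-- first descents to h + 1 and then to h; the part before the second cut is a first descent from
-- h + 1 to h.
walks-firstDescent : ∀ L → FirstDescentDecomposition L
walks-firstDescent = <-rec FirstDescentDecomposition step
  where
  step : ∀ L → (∀ {L′} → L′ < L → FirstDescentDecomposition L′) → FirstDescentDecomposition L
  step zero          _  bad h up = refl
  step (suc zero)    _  bad h up with up ∧ bad (suc h)
  ... | true  = refl
  ... | false = cong (0ℤ +_) (sym (ℤP.*-identityˡ (walks bad h false 0)))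
  step (suc (suc L)) IH bad h up = begin
      walks bad (suc (suc h)) true (suc L) + walksDown bad (suc h) up (suc L)
    ≡⟨ cong₂ _+_ (trans (IH ℕP.≤-refl bad (suc h) true) viaLevel-h) lastStep ⟩
      conv (conv E₁ (λ j → E₀ (suc j))) K L + E 1 * K (suc L)
    ≡⟨ cong (_+ E 1 * K (suc L)) (conv-cong≤ L twoLevels (λ _ _ → refl)) ⟩
      conv (λ j → E (suc (suc j))) K L + E 1 * K (suc L)
    ≡⟨ ℤP.+-comm (conv (λ j → E (suc (suc j))) K L) (E 1 * K (suc L)) ⟩
      E 1 * K (suc L) + conv (λ j → E (suc (suc j))) K L
    ≡⟨ sym (ℤP.+-identityˡ _) ⟩
      0ℤ + (E 1 * K (suc L) + conv (λ j → E (suc (suc j))) K L)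
    ∎
    where
    open ≡-Reasoning
    E E₀ E₁ K : ℕ → ℤ
    E  = firstDescent bad h up
    E₀ = firstDescent bad h false
    E₁ = firstDescent bad (suc h) true
    K  = walks bad h false
    viaLevel-h : conv E₁ (walks bad (suc h) false) (suc L) ≡ conv (conv E₁ (λ j → E₀ (suc j))) K L
    viaLevel-h = trans (conv-cong≤ (suc L) {E₁} {E₁} (λ _ _ → refl) (λ k k≤1+L → IH (s≤s k≤1+L) bad h false))
                       (conv-shiftˡ L E₁ E₀ K refl)
    twoLevels : ∀ j → j ≤ L → conv E₁ (λ j → E₀ (suc j)) j ≡ E (suc (suc j))
    twoLevels j j≤L = sym (begin
        walks (shiftBad (suc h) bad) 1 true j + 0ℤ
      ≡⟨ ℤP.+-identityʳ _ ⟩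
        walks (shiftBad (suc h) bad) 1 true j
      ≡⟨ IH (s≤s (ℕP.m≤n⇒m≤1+n j≤L)) (shiftBad (suc h) bad) 0 true ⟩
        conv (firstDescent (shiftBad (suc h) bad) 0 true) (walks (shiftBad (suc h) bad) 0 false) j
      ≡⟨ conv-cong j (firstDescent-shiftBad bad h) (walks-shiftBad bad h) ⟩
        conv E₁ (λ j → E₀ (suc j)) j
      ∎)
    lastStep : walksDown bad (suc h) up (suc L) ≡ E 1 * K (suc L)
    lastStep with up ∧ bad (suc h)
    ... | true  = refl
    ... | false = sym (ℤP.*-identityˡ (K (suc L)))

-- prime bad j counts the prime Dyck paths of size j + 1: an up-step followed by a first descent
-- from height 1 to 0.
prime : (ℕ → Bool) → ℕ → ℤ
prime bad j = firstDescent bad 0 true (suc (2 ℕ.* j))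

isEven-odd : ∀ k → isEven (suc (2 ℕ.* k) ℕ.+ 0) ≡ false
isEven-odd k = trans (cong isEven (ℕP.+-identityʳ (suc (2 ℕ.* k)))) (cong not (isEven-double k))

walks-recurrence : ∀ bad N →
  walks bad 0 false (2 ℕ.* suc N) ≡ conv (prime bad) (λ k → walks bad 0 false (2 ℕ.* k)) N
walks-recurrence bad N = begin
    walks bad 0 false (2 ℕ.* suc N)
  ≡⟨ cong (walks bad 0 false) (ℕP.*-suc 2 N) ⟩
    walks bad 1 true (suc (2 ℕ.* N)) + 0ℤ
  ≡⟨ ℤP.+-identityʳ _ ⟩
    walks bad 1 true (suc (2 ℕ.* N))
  ≡⟨ walks-firstDescent (suc (2 ℕ.* N)) bad 0 true ⟩
    conv (firstDescent bad 0 true) (walks bad 0 false) (suc (2 ℕ.* N))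
  ≡⟨ conv-odd N (firstDescent bad 0 true) (walks bad 0 false) firstDescent-even
               (λ k → walks-parity bad (suc (2 ℕ.* k)) 0 false (isEven-odd k)) ⟩
    conv (prime bad) (λ k → walks bad 0 false (2 ℕ.* k)) N
  ∎
  where
  open ≡-Reasoning
  firstDescent-even : ∀ j → firstDescent bad 0 true (2 ℕ.* j) ≡ 0ℤ
  firstDescent-even zero    = refl
  firstDescent-even (suc j) = trans (cong (firstDescent bad 0 true) (ℕP.*-suc 2 j))
                                    (walks-parity (shiftBad 1 bad) (suc (2 ℕ.* j)) 0 true (isEven-odd j))

-- Residue classes

T-ext : ∀ {x y : Bool} → (T x → T y) → (T y → T x) → x ≡ y
T-ext {false} {false} _ _ = refl
T-ext {false} {true}  _ y⇒x = ⊥-elim (y⇒x _)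
T-ext {true}  {false} x⇒y _ = ⊥-elim (x⇒y _)
T-ext {true}  {true}  _ _ = refl

∧-intro : ∀ {x y} → T x → T y → T (x ∧ y)
∧-intro tx ty = Equivalence.from BoolP.T-∧ (tx , ty)

∧-elim : ∀ {x y} → T (x ∧ y) → T x × T y
∧-elim = Equivalence.to BoolP.T-∧

any-allFin⁺ : ∀ {n} (p : Fin n → Bool) i → T (p i) → T (any p (allFin n))
any-allFin⁺ p i pᵢ = any⁺ p (tabulate⁺ i pᵢ)

any-allFin⁻ : ∀ {n} (p : Fin n → Bool) → T (any p (allFin n)) → ∃[ i ] T (p i)
any-allFin⁻ {n} p h = tabulate⁻ (any⁻ p (allFin n) h)

module Residues (m : ℕ) .{{_ : NonZero m}} where

  ∸%≡0⇒%≡ : ∀ {a b} → b ≤ a → (a ∸ b) % m ≡ 0 → a % m ≡ b % m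
  ∸%≡0⇒%≡ {a} {b} b≤a e = trans (cong (_% m) (sym (ℕP.m+[n∸m]≡n b≤a))) (%-remove-+ʳ b (m%n≡0⇒n∣m (a ∸ b) m e))

  %≡⇒∸%≡0 : ∀ {a b} → b ≤ a → a % m ≡ b % m → (a ∸ b) % m ≡ 0
  %≡⇒∸%≡0 {a} {b} b≤a e = trans (cong (_% m) a∸b≡) (m*n%n≡0 (a / m ∸ b / m) m)
    where
    a∸b≡ : a ∸ b ≡ (a / m ∸ b / m) ℕ.* m
    a∸b≡ = trans (cong₂ _∸_ (m≡m%n+[m/n]*n a m) (trans (m≡m%n+[m/n]*n b m) (cong (ℕ._+ b / m ℕ.* m) (sym e))))
                 (trans (ℕP.[m+n]∸[m+o]≡n∸o (a % m) (a / m ℕ.* m) (b / m ℕ.* m))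
                        (sym (ℕP.*-distribʳ-∸ m (a / m) (b / m))))

  ∣⊖∣≡∸ : ∀ {a b} → b ≤ a → ∣ a ⊖ b ∣ ≡ a ∸ b
  ∣⊖∣≡∸ {a} {b} b≤a = trans (ℤP.∣m⊖n∣≡∣n⊖m∣ a b) (ℤP.∣⊖∣-≤ b≤a)

  ∣⊖∣%≡0⇒%≡ : ∀ a b → ∣ a ⊖ b ∣ % m ≡ 0 → a % m ≡ b % m
  ∣⊖∣%≡0⇒%≡ a b e with ℕP.≤-total b a
  ... | inj₁ b≤a = ∸%≡0⇒%≡ b≤a (trans (cong (_% m) (sym (∣⊖∣≡∸ b≤a))) e)
  ... | inj₂ a≤b = sym (∸%≡0⇒%≡ a≤b (trans (cong (_% m) (sym (ℤP.∣⊖∣-≤ a≤b))) e))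

  %≡⇒∣⊖∣%≡0 : ∀ a b → a % m ≡ b % m → ∣ a ⊖ b ∣ % m ≡ 0
  %≡⇒∣⊖∣%≡0 a b e with ℕP.≤-total b a
  ... | inj₁ b≤a = trans (cong (_% m) (∣⊖∣≡∸ b≤a)) (%≡⇒∸%≡0 b≤a e)
  ... | inj₂ a≤b = trans (cong (_% m) (ℤP.∣⊖∣-≤ a≤b)) (%≡⇒∸%≡0 a≤b (sym e))

  congℤ⇒%≡ : ∀ a b → T (congℤ m (ℤ.+ a) (ℤ.+ b)) → a % m ≡ b % m
  congℤ⇒%≡ a b c = ∣⊖∣%≡0⇒%≡ a b (trans (cong (λ z → ∣ z ∣ % m) (sym (ℤP.m-n≡m⊖n a b))) (ℕP.≡ᵇ⇒≡ _ 0 c))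

  %≡⇒congℤ : ∀ a b → a % m ≡ b % m → T (congℤ m (ℤ.+ a) (ℤ.+ b))
  %≡⇒congℤ a b e = ℕP.≡⇒≡ᵇ _ 0 (trans (cong (λ z → ∣ z ∣ % m) (ℤP.m-n≡m⊖n a b)) (%≡⇒∣⊖∣%≡0 a b e))

  %-suc-injective : ∀ a b → suc a % m ≡ suc b % m → a % m ≡ b % m
  %-suc-injective a b e = ∣⊖∣%≡0⇒%≡ a b
    (trans (cong (λ z → ∣ z ∣ % m) (sym (ℤP.[1+m]⊖[1+n]≡m⊖n a b))) (%≡⇒∣⊖∣%≡0 (suc a) (suc b) e))

  %-suc-cong : ∀ a b → a % m ≡ b % m → suc a % m ≡ suc b % m
  %-suc-cong a b e = trans (%-distribˡ-+ 1 a m) (trans (cong (λ x → (1 % m ℕ.+ x) % m) e) (sym (%-distribˡ-+ 1 b m)))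

  inClass⁺ : ∀ V h j → T (V j) → suc h % m ≡ suc (toℕ j) % m → T (inClass m V (suc h))
  inClass⁺ V h j vⱼ e = any-allFin⁺ _ j (∧-intro vⱼ (%≡⇒congℤ (suc h) (suc (toℕ j)) e))

  inClass⁻ : ∀ V h → T (inClass m V (suc h)) → ∃[ j ] T (V j) × suc h % m ≡ suc (toℕ j) % m
  inClass⁻ V h c with any-allFin⁻ _ c
  ... | j , cⱼ with ∧-elim {V j} cⱼ
  ...   | vⱼ , e = j , vⱼ , congℤ⇒%≡ (suc h) (suc (toℕ j)) e

  shift⁺ : ∀ V k j → T (V j) → suc (toℕ k) % m ≡ toℕ j % m → T (shift V -[1+ 0 ] k)
  shift⁺ V k j vⱼ e = any-allFin⁺ _ j (∧-intro vⱼ (%≡⇒congℤ (suc (toℕ k)) (toℕ j) e))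

  shift⁻ : ∀ V k → T (shift V -[1+ 0 ] k) → ∃[ j ] T (V j) × suc (toℕ k) % m ≡ toℕ j % m
  shift⁻ V k c with any-allFin⁻ _ c
  ... | j , cⱼ with ∧-elim {V j} cⱼ
  ...   | vⱼ , e = j , vⱼ , congℤ⇒%≡ (suc (toℕ k)) (toℕ j) e

  inClass-shift : ∀ V x → inClass m V (suc (suc x)) ≡ inClass m (shift V -[1+ 0 ]) (suc x)
  inClass-shift V x = T-ext to from
    where
    to : T (inClass m V (suc (suc x))) → T (inClass m (shift V -[1+ 0 ]) (suc x))
    to c with inClass⁻ V (suc x) c
    ... | j , vⱼ , e = inClass⁺ _ x k (shift⁺ V k j vⱼ (trans k+1≡x+1 x+1≡j)) (sym k+1≡x+1)
      where
      k : Fin m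
      k = fromℕ< (m%n<n x m)
      k+1≡x+1 : suc (toℕ k) % m ≡ suc x % m
      k+1≡x+1 = %-suc-cong (toℕ k) x (trans (cong (_% m) (FinP.toℕ-fromℕ< (m%n<n x m))) (m%n%n≡m%n x m))
      x+1≡j : suc x % m ≡ toℕ j % m
      x+1≡j = %-suc-injective (suc x) (toℕ j) e
    from : T (inClass m (shift V -[1+ 0 ]) (suc x)) → T (inClass m V (suc (suc x)))
    from c with inClass⁻ _ x c
    ... | k , sₖ , x+1≡k+1 with shift⁻ V k sₖ
    ...   | j , vⱼ , k+1≡j = inClass⁺ V (suc x) j vⱼ (%-suc-cong (suc x) (toℕ j) (trans x+1≡k+1 k+1≡j))

  1∈ᵇ≡inClass-1 : ∀ V → (1 ∈ᵇ V) ≡ inClass m V 1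
  1∈ᵇ≡inClass-1 V = cong or (ListP.map-cong pointwise (allFin m))
    where
    pointwise : ∀ i → (suc (toℕ i) ℕ.≡ᵇ 1) ∧ V i ≡ V i ∧ congℤ m (ℤ.+ 1) (ℤ.+ suc (toℕ i))
    pointwise zero    = sym (BoolP.∧-identityʳ (V zero))
    pointwise (suc i) = sym (trans (cong (V (suc i) ∧_) (T-ext distinct ⊥-elim)) (BoolP.∧-zeroʳ (V (suc i))))
      where
      distinct : T (congℤ m (ℤ.+ 1) (ℤ.+ suc (suc (toℕ i)))) → T false
      distinct c = ℕP.0≢1+n (trans (sym (m<n⇒m%n≡m (ℕP.≤-trans (s≤s z≤n) (FinP.toℕ<n (suc i)))))
                             (trans (%-suc-injective 0 (suc (toℕ i)) (congℤ⇒%≡ 1 (suc (suc (toℕ i))) c))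
                                    (m<n⇒m%n≡m (FinP.toℕ<n (suc i)))))

hankel-cong : ∀ k n {F G : Series} → (∀ i → F i ≡ G i) → hankel k n F ≡ hankel k n G
hankel-cong k n F≗G = det-cong n (λ i j → F≗G (k ℕ.+ toℕ i ℕ.+ toℕ j))

hankel₁-D≡hankel₀-prime : ∀ m .{{_ : NonZero m}} V n → hankel 1 n (D m V) ≡ hankel 0 n (prime (inClass m V))
hankel₁-D≡hankel₀-prime m V n =
  trans (hankel-cong 1 n (D≡walks m V))
        (hankel-recurrence (λ k → walks (inClass m V) 0 false (2 ℕ.* k)) (prime (inClass m V)) refl
                           (walks-recurrence (inClass m V)) n)

prime-suc : ∀ m .{{_ : NonZero m}} V j → prime (inClass m V) (suc j) ≡ D m (shift V -[1+ 0 ]) (suc j)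
prime-suc m V j = begin
    firstDescent (inClass m V) 0 true (suc (2 ℕ.* suc j))
  ≡⟨ cong (λ L → firstDescent (inClass m V) 0 true (suc L)) (ℕP.*-suc 2 j) ⟩
    walks (shiftBad 1 (inClass m V)) 0 true (suc (suc (2 ℕ.* j)))
  ≡⟨ walks-cong (Residues.inClass-shift m V) (suc (suc (2 ℕ.* j))) 0 false ⟩
    -- the flag is irrelevant at height 0, where no down-step is possible
    walks (inClass m (shift V -[1+ 0 ])) 0 false (suc (suc (2 ℕ.* j)))
  ≡⟨ sym (trans (D≡walks m (shift V -[1+ 0 ]) (suc j)) (cong (walks _ 0 false) (ℕP.*-suc 2 j))) ⟩
    D m (shift V -[1+ 0 ]) (suc j)
  ∎
  where open ≡-Reasoning

lemma2p5 : (m : ℕ) .{{_ : NonZero m}} → 2 ≤ m → (V : Fin m → Bool) → (n : ℕ) → 1 ≤ n →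
    ((1 ∈ᵇ V) ≡ false → hankel 1 n (D m V) ≡ hankel 0 n (D m (shift V -[1+ 0 ])))
    × ((1 ∈ᵇ V) ≡ true → hankel 1 n (D m V) ≡ hankel 0 n (minusOne (D m (shift V -[1+ 0 ]))))
lemma2p5 m _ V n _ = (λ 1∉V → trans (hankel₁-D≡hankel₀-prime m V n) (hankel-cong 0 n (agree 1∉V)))
                   , (λ 1∈V → trans (hankel₁-D≡hankel₀-prime m V n) (hankel-cong 0 n (agree′ 1∈V)))
  where
  V′ = shift V -[1+ 0 ]
  prime-zero : prime (inClass m V) 0 ≡ (if 1 ∈ᵇ V then 0ℤ else 1ℤ)
  prime-zero = cong (λ b → if b then 0ℤ else 1ℤ) (sym (Residues.1∈ᵇ≡inClass-1 m V))
  agree : (1 ∈ᵇ V) ≡ false → ∀ i → prime (inClass m V) i ≡ D m V′ i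
  agree 1∉V zero    = trans prime-zero (cong (λ b → if b then 0ℤ else 1ℤ) 1∉V)
  agree 1∉V (suc j) = prime-suc m V j
  agree′ : (1 ∈ᵇ V) ≡ true → ∀ i → prime (inClass m V) i ≡ minusOne (D m V′) i
  agree′ 1∈V zero    = trans prime-zero (cong (λ b → if b then 0ℤ else 1ℤ) 1∈V)
  agree′ 1∈V (suc j) = prime-suc m V j
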